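{- Let $\pi\in S_n$ and let $d$ be a tail-bound descent of $\pi$. Then \[|s^{ -1}(\pi)|=\sum_{H\in\mathrm{SW}_d(\pi)}|s^{ -1}(\pi_U^H)|\cdot|s^{ -1}(\pi_S^H)|.\]
   Context: A permutation is an ordering of a finite set of positive integers in one-line notation; $S_n$ is the set of permutations of $\{1,\dots,n\}$. A descent of $\pi=\pi_1\cdots\pi_n$ is an index $i\in[n-1]$ with $\pi_i>\pi_{i+1}$. The stack-sorting map $s$: given an input permutation, repeatedly do the following: if the stack is empty or the next input entry is smaller than the entry on top of the stack, push the next input entry onto the stack; otherwise pop the top of the stack and append it to the output. Stop when all entries are output; $s(\pi)$ is the output. $s^{ -1}(\tau)$ is the set of permutations (of the same set of entries as $\tau$) mapped to $\tau$; the empty permutation has exactly one preimage, itself. A hook of $\pi$ is a pair of indices $i<j$ with $\pi_i<\pi_j$; $(i,\pi_i)$ is its southwest endpoint and $(j,\pi_j)$ its northeast endpoint. $\mathrm{SW}_i(\pi)$ is the set of hooks with southwest endpoint $(i,\pi_i)$. For such a hook $H$, $\pi_U^H=\pi_1\cdots\pi_i\pi_{j+1}\cdots\pi_n$ and $\pi_S^H=\pi_{i+1}\cdots\pi_{j-1}$. The tail length $\operatorname{tl}(\pi)$ of $\pi\in S_n$ is the smallest nonnegative integer $\ell$ with $\pi_{n-\ell}\ne n-\ell$ (with $\operatorname{tl}(12\cdots n)=n$); the tail of $\pi$ is the set of points $(m,m)$ for $n-\operatorname{tl}(\pi)+1\le m\le n$. A descent $d$ is tail-bound if every hook in $\mathrm{SW}_d(\pi)$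 has its northeast endpoint in the tail of $\pi$. -}

module Defs where

open import Data.Nat using (ℕ; zero; suc; _+_; _∸_; _<_; _≤_; _<?_; _≟_)
open import Data.List using (List; []; _∷_; _++_; length; take; drop; map; filter; concatMap; upTo)
open import Data.List.Properties using (≡-dec)
open import Data.List.Relation.Binary.Permutation.Propositional using (_↭_)
open import Data.Product using (_×_)
open import Relation.Nullary using (yes; no)
open import Data.Bool using (if_then_else_)
open import Data.Nat using (_<ᵇ_)
open import Relation.Binary.PropositionalEquality using (_≡_)

-- Permutations are lists of positive integers in one-line notation.
-- π ∈ S_n
InS : ℕ → List ℕ → Set
InS n π = π ↭ map suc (upTo n)

-- The stack-sorting algorithm, run literally: input, stack (top = head).
stackGo : List ℕ → List ℕ → List ℕ
stackGo []       st       = st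
stackGo (x ∷ xs) []       = stackGo xs (x ∷ [])
stackGo (x ∷ xs) (t ∷ st) =
  if x <ᵇ t
  then stackGo xs (x ∷ t ∷ st)
  else t ∷ stackGo (x ∷ xs) st

s : List ℕ → List ℕ
s π = stackGo π []

insertions : ℕ → List ℕ → List (List ℕ)
insertions x []       = (x ∷ []) ∷ []
insertions x (y ∷ ys) = (x ∷ y ∷ ys) ∷ map (y ∷_) (insertions x ys)

perms : List ℕ → List (List ℕ)
perms []       = [] ∷ []
perms (x ∷ xs) = concatMap (insertions x) (perms xs)

preCount : List ℕ → ℕ
preCount τ = length (filter (λ σ → ≡-dec _≟_ (s σ) τ) (perms τ))

-- entry at 1-based position k (0 if out of range)
at : List ℕ → ℕ → ℕ
at []       _             = 0
at (x ∷ xs) zero          = 0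
at (x ∷ xs) (suc zero)    = x
at (x ∷ xs) (suc (suc k)) = at xs (suc k)

Descent : List ℕ → ℕ → Set
Descent π i = (1 ≤ i) × (i < length π) × (at π (suc i) < at π i)

Hook : List ℕ → ℕ → ℕ → Set
Hook π i j = (1 ≤ i) × (i < j) × (j ≤ length π) × (at π i < at π j)

-- the list of j with (i, j) a hook: SW_i(π), listed by northeast position
range : ℕ → ℕ → List ℕ   -- range a b = a, a+1, ..., b
range a b = map (a +_) (upTo (suc b ∸ a))

SW : List ℕ → ℕ → List ℕ
SW π i = filter (λ j → at π i <? at π j) (range (suc i) (length π))

πU : List ℕ → ℕ → ℕ → List ℕ
πU π i j = take i π ++ drop j π

πS : List ℕ → ℕ → ℕ → List ℕ
πS π i j = drop i (take (j ∸ 1) π)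

-- tail length: number of consecutive fixed points n, n-1, ... (tl(12⋯n) = n)
tlAux : List ℕ → ℕ → ℕ
tlAux π zero    = 0
tlAux π (suc k) with at π (suc k) ≟ suc k
... | yes _ = suc (tlAux π k)
... | no  _ = 0

tl : List ℕ → ℕ
tl π = tlAux π (length π)

InTail : List ℕ → ℕ → Set
InTail π j = (length π ∸ tl π + 1 ≤ j) × (j ≤ length π) × (at π j ≡ j)

TailBound : List ℕ → ℕ → Set
TailBound π d = Descent π d × (∀ j → Hook π d j → InTail π j)

module Submission where

-- Write π = A x B T with x = π_d, B the maximal block of entries below x after it
-- (nonempty, as d is a descent) and T the rest.  Hooks from x end in T, so T is the tail
-- and exceeds every entry of A x B; a hook is a splitting T = h₁ t h₃ with π_U = A x h₃
-- and π_S = B h₁.  The claim becomes the main identity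
--   |s⁻¹(A x B T)| = Σ_{T = h₁ t h₃} |s⁻¹(A x h₃)| · |s⁻¹(B h₁)|,
-- proved by induction on T from the decomposition lemma (if m exceeds all of W then
-- |s⁻¹(W m)| = Σ_{W = U V} |s⁻¹(U)|·|s⁻¹(V)|, as s(L m R) = s(L) s(R) m) and the
-- vanishing lemma (|s⁻¹(W y)| = 0 when an entry of W exceeds y): expanding both sides at
-- the last entry of T, they agree after exchanging finite sums.

open import Defs
open import Data.Nat using (ℕ; _*_)
open import Data.List using (map)
open import Data.Nat.ListAction using (sum)
open import Relation.Binary.PropositionalEquality using (_≡_)

import Algebra.Properties.CommutativeSemigroup as CommSemigroup
open import Data.Bool using (true; false; T)
open import Data.Empty using (⊥-elim)
open import Data.List
  using (List; []; _∷_; _++_; _∷ʳ_; length; filter; concatMap; cartesianProduct; take; drop; upTo; applyUpTo)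
open import Data.List.Membership.Propositional using (_∈_; _∉_; find; lose)
open import Data.List.Membership.Propositional.Properties
  using (∈-map⁺; ∈-map⁻; ∈-++⁺ˡ; ∈-++⁺ʳ; ∈-∃++; ∈-upTo⁻; ∈-applyUpTo⁺; ∈-applyUpTo⁻; ∈-filter⁺; ∈-filter⁻;
         ∈-concatMap⁺; ∈-concatMap⁻; ∈-cartesianProduct⁺; ∈-cartesianProduct⁻)
open import Data.List.Membership.Propositional.Properties.WithK using (unique∧set⇒bag)
open import Data.List.Properties
  using (≡-dec; ∷-injective; ∷-injectiveˡ; ∷-injectiveʳ; ∷ʳ-injective; ++-assoc; ++-identityʳ; length-++;
         length-map; length-upTo; length-applyUpTo; map-++; map-∘; map-id; map-applyUpTo)
open import Data.List.Relation.Binary.BagAndSetEquality using (∼bag⇒↭)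
open import Data.List.Relation.Binary.Permutation.Propositional
  using (_↭_; prep; ↭-refl; ↭-sym; ↭-trans; ↭-reflexive; ↭⇒↭ₛ)
open import Data.List.Relation.Binary.Permutation.Propositional.Properties
  using (shift; ∈-resp-↭; drop-mid; ↭-empty-inv; All-resp-↭; ↭-length; ++⁺; ∷↭∷ʳ)
open import Data.List.Relation.Unary.All as All using (All; []; _∷_)
import Data.List.Relation.Unary.All.Properties as All
open import Data.List.Relation.Unary.AllPairs as AllPairs using (AllPairs; []; _∷_)
import Data.List.Relation.Unary.AllPairs.Properties as AllPairs
open import Data.List.Relation.Unary.Any using (here; there)
open import Data.List.Relation.Unary.Unique.Propositional using (Unique)
import Data.List.Relation.Unary.Unique.Propositional.Properties as Unique
open import Data.Nat using (zero; suc; _+_; _∸_; _<_; _≤_; _<ᵇ_; _≟_; _≤?_; _<?_; s≤s; z≤n; s≤s⁻¹)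
open import Data.Nat.ListAction.Properties using (sum-++)
open import Data.Nat.Properties
open import Data.Product using (_×_; _,_; ∃; ∃₂; proj₁; proj₂; map₁; map₂)
open import Data.Sum using (_⊎_; inj₁; inj₂)
open import Function using (_∘_; id; mk⇔)
open import Relation.Binary.PropositionalEquality
  using (setoid; refl; sym; trans; cong; cong₂; subst; subst₂; _≢_; module ≡-Reasoning)
open import Data.List.Relation.Binary.Permutation.Setoid.Properties (setoid ℕ) using (Unique-resp-↭)
open import Relation.Nullary using (¬_; Dec; yes; no)
open import Relation.Unary using (Decidable)

open CommSemigroup +-commutativeSemigroup using (interchange; x∙yz≈xz∙y)
open CommSemigroup *-commutativeSemigroup using () renaming (xy∙z≈xz∙y to *-swapʳ)

private variable A B : Set

∑ : List A → (A → ℕ) → ℕ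
∑ xs f = sum (map f xs)

infix 5 ∑
syntax ∑ xs (λ x → e) = ∑[ x ← xs ] e

∑-cong : ∀ (xs : List A) {f g : A → ℕ} → (∀ {a} → a ∈ xs → f a ≡ g a) → ∑ xs f ≡ ∑ xs g
∑-cong []       _ = refl
∑-cong (x ∷ xs) h = cong₂ _+_ (h (here refl)) (∑-cong xs (h ∘ there))

∑-zero : ∀ (xs : List A) {f : A → ℕ} → (∀ {a} → a ∈ xs → f a ≡ 0) → ∑ xs f ≡ 0
∑-zero []       _ = refl
∑-zero (x ∷ xs) h = cong₂ _+_ (h (here refl)) (∑-zero xs (h ∘ there))

∑-++ : ∀ (xs ys : List A) (f : A → ℕ) → ∑ (xs ++ ys) f ≡ ∑ xs f + ∑ ys f
∑-++ xs ys f = trans (cong sum (map-++ f xs ys)) (sum-++ (map f xs) (map f ys))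

∑-map : ∀ (g : A → B) (xs : List A) (f : B → ℕ) → ∑ (map g xs) f ≡ ∑ xs (f ∘ g)
∑-map g xs f = cong sum (sym (map-∘ xs))

∑-+ : ∀ (xs : List A) (f g : A → ℕ) → ∑[ a ← xs ] (f a + g a) ≡ ∑ xs f + ∑ xs g
∑-+ []       f g = refl
∑-+ (x ∷ xs) f g = trans (cong (f x + g x +_) (∑-+ xs f g)) (interchange (f x) (g x) (∑ xs f) (∑ xs g))

∑-*ˡ : ∀ k (xs : List A) (f : A → ℕ) → k * ∑ xs f ≡ ∑[ a ← xs ] (k * f a)
∑-*ˡ k []       f = *-zeroʳ k
∑-*ˡ k (x ∷ xs) f = trans (*-distribˡ-+ k (f x) (∑ xs f)) (cong (k * f x +_) (∑-*ˡ k xs f))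

∑-*ʳ : ∀ k (xs : List A) (f : A → ℕ) → ∑ xs f * k ≡ ∑[ a ← xs ] (f a * k)
∑-*ʳ k []       f = refl
∑-*ʳ k (x ∷ xs) f = trans (*-distribʳ-+ k (f x) (∑ xs f)) (cong (f x * k +_) (∑-*ʳ k xs f))

∑-swap : ∀ (xs : List A) (ys : List B) (g : A → B → ℕ) →
  ∑[ a ← xs ] ∑[ b ← ys ] g a b ≡ ∑[ b ← ys ] ∑[ a ← xs ] g a b
∑-swap []       ys g = sym (∑-zero ys (λ _ → refl))
∑-swap (x ∷ xs) ys g = trans (cong (∑ ys (g x) +_) (∑-swap xs ys g)) (sym (∑-+ ys (g x) _))

∑-factor-swap : ∀ (xs : List A) (ys : List B) (F : A → ℕ) (K : A → B → ℕ) (J : B → ℕ) →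
  ∑[ a ← xs ] F a * (∑[ b ← ys ] K a b * J b) ≡ ∑[ b ← ys ] (∑[ a ← xs ] F a * K a b) * J b
∑-factor-swap xs ys F K J = begin
  ∑[ a ← xs ] F a * (∑[ b ← ys ] K a b * J b)
    ≡⟨ ∑-cong xs (λ {a} _ → ∑-*ˡ (F a) ys (λ b → K a b * J b)) ⟩
  ∑[ a ← xs ] ∑[ b ← ys ] F a * (K a b * J b)
    ≡⟨ ∑-swap xs ys (λ a b → F a * (K a b * J b)) ⟩
  ∑[ b ← ys ] ∑[ a ← xs ] F a * (K a b * J b)
    ≡⟨ ∑-cong ys (λ {b} _ → ∑-cong xs (λ {a} _ → sym (*-assoc (F a) (K a b) (J b)))) ⟩
  ∑[ b ← ys ] ∑[ a ← xs ] F a * K a b * J b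
    ≡⟨ ∑-cong ys (λ {b} _ → sym (∑-*ʳ (J b) xs (λ a → F a * K a b))) ⟩
  ∑[ b ← ys ] (∑[ a ← xs ] F a * K a b) * J b ∎
  where open ≡-Reasoning

when : ∀ {P : Set} → Dec P → ℕ → ℕ
when (yes _) v = v
when (no _)  v = 0

∑-filter : ∀ {P : A → Set} (P? : Decidable P) xs (f : A → ℕ) →
  ∑ (filter P? xs) f ≡ ∑[ a ← xs ] when (P? a) (f a)
∑-filter P? []       f = refl
∑-filter P? (x ∷ xs) f with P? x
... | yes _ = cong (f x +_) (∑-filter P? xs f)
... | no  _ = ∑-filter P? xs f

++-∷-cancel : ∀ {m : A} (L L' : List A) {R R'} → m ∉ L → m ∉ L' →
  L ++ m ∷ R ≡ L' ++ m ∷ R' → L ≡ L' × R ≡ R'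
++-∷-cancel []      []       _    _     eq = refl , ∷-injectiveʳ eq
++-∷-cancel []      (y ∷ L') _    m∉L'  eq = ⊥-elim (m∉L' (here (∷-injectiveˡ eq)))
++-∷-cancel (x ∷ L) []       m∉L  _     eq = ⊥-elim (m∉L (here (sym (∷-injectiveˡ eq))))
++-∷-cancel (x ∷ L) (y ∷ L') m∉L  m∉L'  eq with ∷-injective eq
... | refl , eq′ with ++-∷-cancel L L' (m∉L ∘ there) (m∉L' ∘ there) eq′
... | refl , refl = refl , refl

AllPairs-++⁻ : ∀ {R : A → A → Set} (xs : List A) {ys} → AllPairs R (xs ++ ys) → AllPairs R xs × AllPairs R ys
AllPairs-++⁻ []       rys              = [] , rys
AllPairs-++⁻ (x ∷ xs) (rx ∷ rxsys) with AllPairs-++⁻ xs rxsys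
... | rxs , rys = All.++⁻ˡ xs rx ∷ rxs , rys

snoc-view : ∀ (xs : List A) → xs ≡ [] ⊎ ∃₂ λ ys y → xs ≡ ys ∷ʳ y
snoc-view []       = inj₁ refl
snoc-view (x ∷ xs) with snoc-view xs
... | inj₁ refl             = inj₂ ([] , x , refl)
... | inj₂ (ys , y , refl) = inj₂ (x ∷ ys , y , refl)

length-∷ʳ : ∀ (xs : List A) x → length (xs ∷ʳ x) ≡ suc (length xs)
length-∷ʳ xs x = trans (length-++ xs) (+-comm (length xs) 1)

∈-concatMap⁺′ : ∀ (f : A → List B) {xs a v} → a ∈ xs → v ∈ f a → v ∈ concatMap f xs
∈-concatMap⁺′ f a∈ v∈ = ∈-concatMap⁺ f (lose a∈ v∈)

∈-concatMap⁻′ : ∀ (f : A → List B) xs {v} → v ∈ concatMap f xs → ∃ λ a → a ∈ xs × v ∈ f a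
∈-concatMap⁻′ f xs v∈ = find (∈-concatMap⁻ f v∈)

map-unique : ∀ (f : A → B) {xs} → (∀ {a b} → a ∈ xs → b ∈ xs → f a ≡ f b → a ≡ b) →
  Unique xs → Unique (map f xs)
map-unique f inj []         = []
map-unique f inj (a∉ ∷ u) =
  All.map⁺ (All.tabulate (λ b∈ e → All.lookup a∉ b∈ (inj (here refl) (there b∈) e))) ∷
  map-unique f (λ a∈ b∈ → inj (there a∈) (there b∈)) u

concatMap-unique : ∀ (f : A → List B) xs → Unique xs →
  (∀ {a} → a ∈ xs → Unique (f a)) →
  (∀ {a b v} → a ∈ xs → b ∈ xs → v ∈ f a → v ∈ f b → a ≡ b) →
  Unique (concatMap f xs)
concatMap-unique f []       _          _    _        = []
concatMap-unique f (a ∷ xs) (a∉ ∷ u) uniq disjoint =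
  Unique.++⁺ (uniq (here refl))
    (concatMap-unique f xs u (uniq ∘ there) (λ p q → disjoint (there p) (there q)))
    separate
  where
  separate : ∀ {v} → ¬ (v ∈ f a × v ∈ concatMap f xs)
  separate (v∈fa , v∈rest) with ∈-concatMap⁻′ f xs v∈rest
  ... | b , b∈ , v∈fb = All.lookup a∉ b∈ (disjoint (here refl) (there b∈) v∈fa v∈fb)

same-members⇒same-length : ∀ {xs ys : List A} → Unique xs → Unique ys →
  (∀ {z} → z ∈ xs → z ∈ ys) → (∀ {z} → z ∈ ys → z ∈ xs) → length xs ≡ length ys
same-members⇒same-length uxs uys to from =
  ↭-length (∼bag⇒↭ (unique∧set⇒bag uxs uys (mk⇔ to from)))

length-concatMap : ∀ (f : A → List B) xs → length (concatMap f xs) ≡ ∑[ a ← xs ] length (f a)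
length-concatMap f []       = refl
length-concatMap f (x ∷ xs) = trans (length-++ (f x)) (cong (length (f x) +_) (length-concatMap f xs))

length-cartesianProduct : ∀ (xs : List A) (ys : List B) →
  length (cartesianProduct xs ys) ≡ length xs * length ys
length-cartesianProduct []       ys = refl
length-cartesianProduct (x ∷ xs) ys =
  trans (length-++ (map (x ,_) ys))
        (cong₂ _+_ (length-map (x ,_) ys) (length-cartesianProduct xs ys))

-- Factorisations of a list.  splits W lists each factorisation W = U V once, and
-- pointedSplits W lists each way W = h₁ t h₃ of singling out one entry t.
splits : List A → List (List A × List A)
splits []       = ([] , []) ∷ []
splits (x ∷ xs) = ([] , x ∷ xs) ∷ map (map₁ (x ∷_)) (splits xs)

splits-sound : ∀ (W : List A) {p} → p ∈ splits W → proj₁ p ++ proj₂ p ≡ W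
splits-sound []       (here refl) = refl
splits-sound (x ∷ xs) (here refl) = refl
splits-sound (x ∷ xs) (there p∈) with ∈-map⁻ (map₁ (x ∷_)) p∈
... | p , p∈′ , refl = cong (x ∷_) (splits-sound xs p∈′)

splits-length : ∀ (W : List A) {p} → p ∈ splits W → length (proj₁ p) ≤ length W
splits-length W {U , V} p∈ =
  subst (λ l → length U ≤ length l) (splits-sound W p∈) (subst (length U ≤_) (sym (length-++ U)) (m≤m+n (length U) (length V)))

splits-complete : ∀ (U V : List A) → (U , V) ∈ splits (U ++ V)
splits-complete []      []      = here refl
splits-complete []      (x ∷ V) = here refl
splits-complete (x ∷ U) V       = there (∈-map⁺ (map₁ (x ∷_)) (splits-complete U V))

splits-unique : ∀ (W : List A) → Unique (splits W)
splits-unique []       = [] ∷ []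
splits-unique (x ∷ xs) =
  All.tabulate head-differs ∷ Unique.map⁺ cons-injective (splits-unique xs)
  where
  head-differs : ∀ {p} → p ∈ map (map₁ (x ∷_)) (splits xs) → ([] , x ∷ xs) ≢ p
  head-differs p∈ eq with ∈-map⁻ (map₁ (x ∷_)) p∈
  head-differs p∈ () | _ , _ , refl
  cons-injective : ∀ {p q} → map₁ (x ∷_) p ≡ map₁ (x ∷_) q → p ≡ q
  cons-injective {_ , _} {_ , _} refl = refl

splits-++ : ∀ (xs : List A) y ys → splits (xs ++ y ∷ ys) ≡
  map (map₂ (_++ y ∷ ys)) (splits xs) ++ map (map₁ (λ U → xs ++ y ∷ U)) (splits ys)
splits-++ []       y ys = refl
splits-++ (x ∷ xs) y ys = cong (([] , x ∷ xs ++ y ∷ ys) ∷_) (begin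
  map (map₁ (x ∷_)) (splits (xs ++ y ∷ ys))
    ≡⟨ cong (map (map₁ (x ∷_))) (splits-++ xs y ys) ⟩
  map (map₁ (x ∷_)) (map (map₂ (_++ y ∷ ys)) (splits xs) ++ map (map₁ (λ U → xs ++ y ∷ U)) (splits ys))
    ≡⟨ map-++ (map₁ (x ∷_)) (map (map₂ (_++ y ∷ ys)) (splits xs)) _ ⟩
  map (map₁ (x ∷_)) (map (map₂ (_++ y ∷ ys)) (splits xs)) ++ map (map₁ (x ∷_)) (map (map₁ (λ U → xs ++ y ∷ U)) (splits ys))
    ≡⟨ cong₂ _++_ (trans (sym (map-∘ (splits xs))) (map-∘ (splits xs))) (sym (map-∘ (splits ys))) ⟩
  map (map₂ (_++ y ∷ ys)) (map (map₁ (x ∷_)) (splits xs)) ++ map (map₁ (λ U → x ∷ xs ++ y ∷ U)) (splits ys) ∎)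
  where open ≡-Reasoning

∑-splits-first : ∀ (xs : List A) (f : List A × List A → ℕ) →
  (∀ {p} → p ∈ splits xs → proj₁ p ≢ [] → f p ≡ 0) → ∑ (splits xs) f ≡ f ([] , xs)
∑-splits-first []       f _    = +-identityʳ (f ([] , []))
∑-splits-first (x ∷ xs) f vanish = trans (cong (f ([] , x ∷ xs) +_) rest≡0) (+-identityʳ _)
  where
  rest≡0 : ∑ (map (map₁ (x ∷_)) (splits xs)) f ≡ 0
  rest≡0 = ∑-zero _ (λ p∈ → vanish (there p∈) (nonempty p∈))
    where
    nonempty : ∀ {p} → p ∈ map (map₁ (x ∷_)) (splits xs) → proj₁ p ≢ []
    nonempty p∈ with ∈-map⁻ (map₁ (x ∷_)) p∈
    ... | _ , _ , refl = λ ()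

pointedSplits : List A → List (List A × A × List A)
pointedSplits []       = []
pointedSplits (y ∷ ys) = ([] , y , ys) ∷ map (map₁ (y ∷_)) (pointedSplits ys)

before : List A × A × List A → List A
before = proj₁

pivot : List A × A × List A → A
pivot = proj₁ ∘ proj₂

after : List A × A × List A → List A
after = proj₂ ∘ proj₂

pointedSplits-sound : ∀ (W : List A) {h} → h ∈ pointedSplits W → W ≡ before h ++ pivot h ∷ after h
pointedSplits-sound (y ∷ ys) (here refl) = refl
pointedSplits-sound (y ∷ ys) (there h∈) with ∈-map⁻ (map₁ (y ∷_)) h∈
... | h , h∈′ , refl = cong (y ∷_) (pointedSplits-sound ys h∈′)

pivot-∈ : ∀ (W : List A) {h} → h ∈ pointedSplits W → pivot h ∈ W
pivot-∈ W {h₁ , t , h₃} h∈ rewrite pointedSplits-sound W h∈ = ∈-++⁺ʳ h₁ (here refl)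

pointedSplits-++ : ∀ (xs ys : List A) → pointedSplits (xs ++ ys) ≡
  map (map₂ (map₂ (_++ ys))) (pointedSplits xs) ++ map (map₁ (xs ++_)) (pointedSplits ys)
pointedSplits-++ []       ys = sym (map-id (pointedSplits ys))
pointedSplits-++ (x ∷ xs) ys = cong (([] , x , xs ++ ys) ∷_) (begin
  map (map₁ (x ∷_)) (pointedSplits (xs ++ ys))
    ≡⟨ cong (map (map₁ (x ∷_))) (pointedSplits-++ xs ys) ⟩
  map (map₁ (x ∷_)) (map (map₂ (map₂ (_++ ys))) (pointedSplits xs) ++ map (map₁ (xs ++_)) (pointedSplits ys))
    ≡⟨ map-++ (map₁ (x ∷_)) (map (map₂ (map₂ (_++ ys))) (pointedSplits xs)) _ ⟩
  map (map₁ (x ∷_)) (map (map₂ (map₂ (_++ ys))) (pointedSplits xs)) ++ map (map₁ (x ∷_)) (map (map₁ (xs ++_)) (pointedSplits ys))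
    ≡⟨ cong₂ _++_ (trans (sym (map-∘ (pointedSplits xs))) (map-∘ (pointedSplits xs))) (sym (map-∘ (pointedSplits ys))) ⟩
  map (map₂ (map₂ (_++ ys))) (map (map₁ (x ∷_)) (pointedSplits xs)) ++ map (map₁ ((x ∷ xs) ++_)) (pointedSplits ys) ∎)
  where open ≡-Reasoning

∑-pointedSplits-∷ʳ : ∀ (T : List A) M (f : List A × A × List A → ℕ) →
  ∑ (pointedSplits (T ∷ʳ M)) f ≡ (∑[ h ← pointedSplits T ] f (before h , pivot h , after h ∷ʳ M)) + f (T , M , [])
∑-pointedSplits-∷ʳ T M f = begin
  ∑ (pointedSplits (T ∷ʳ M)) f
    ≡⟨ cong (λ l → ∑ l f) (pointedSplits-++ T (M ∷ [])) ⟩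
  ∑ (map (map₂ (map₂ (_∷ʳ M))) (pointedSplits T) ++ (T ++ [] , M , []) ∷ []) f
    ≡⟨ ∑-++ (map (map₂ (map₂ (_∷ʳ M))) (pointedSplits T)) _ f ⟩
  ∑ (map (map₂ (map₂ (_∷ʳ M))) (pointedSplits T)) f + (f (T ++ [] , M , []) + 0)
    ≡⟨ cong₂ _+_ (∑-map (map₂ (map₂ (_∷ʳ M))) (pointedSplits T) f)
                 (trans (+-identityʳ _) (cong (λ l → f (l , M , [])) (++-identityʳ T))) ⟩
  (∑[ h ← pointedSplits T ] f (before h , pivot h , after h ∷ʳ M)) + f (T , M , []) ∎
  where open ≡-Reasoning

pointedSplits-∷ʳ⁺ : ∀ (T : List A) M {h} → h ∈ pointedSplits T →
  (before h , pivot h , after h ∷ʳ M) ∈ pointedSplits (T ∷ʳ M)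
pointedSplits-∷ʳ⁺ T M h∈ =
  subst (_ ∈_) (sym (pointedSplits-++ T (M ∷ []))) (∈-++⁺ˡ (∈-map⁺ (map₂ (map₂ (_∷ʳ M))) h∈))

-- Fubini for the decompositions W = h₁ t q₁ q₂: cut W = q q₂ and then single out t in q,
-- or single out t in W and then cut what follows it.
∑-splits-pointedSplits : ∀ (g : List A → A → List A → List A → ℕ) W →
  ∑[ q ← splits W ] ∑[ h ← pointedSplits (proj₁ q) ] g (before h) (pivot h) (after h) (proj₂ q)
  ≡ ∑[ h ← pointedSplits W ] ∑[ q ← splits (after h) ] g (before h) (pivot h) (proj₁ q) (proj₂ q)
∑-splits-pointedSplits g []       = refl
∑-splits-pointedSplits {A} g (y ∷ ys) = begin
  ∑[ q ← map (map₁ (y ∷_)) (splits ys) ] Inner q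
    ≡⟨ ∑-map (map₁ (y ∷_)) (splits ys) Inner ⟩
  ∑[ q ← splits ys ] (g [] y (proj₁ q) (proj₂ q) +
                      (∑[ h ← map (map₁ (y ∷_)) (pointedSplits (proj₁ q)) ] g (before h) (pivot h) (after h) (proj₂ q)))
    ≡⟨ ∑-cong (splits ys) (λ {q} _ → cong (g [] y (proj₁ q) (proj₂ q) +_)
                                           (∑-map (map₁ (y ∷_)) (pointedSplits (proj₁ q)) _)) ⟩
  ∑[ q ← splits ys ] (g [] y (proj₁ q) (proj₂ q) +
                      (∑[ h ← pointedSplits (proj₁ q) ] g (y ∷ before h) (pivot h) (after h) (proj₂ q)))
    ≡⟨ ∑-+ (splits ys) _ _ ⟩
  Outer ([] , y , ys) + (∑[ q ← splits ys ] ∑[ h ← pointedSplits (proj₁ q) ] g (y ∷ before h) (pivot h) (after h) (proj₂ q))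
    ≡⟨ cong (Outer ([] , y , ys) +_) (∑-splits-pointedSplits (λ a → g (y ∷ a)) ys) ⟩
  Outer ([] , y , ys) + (∑[ h ← pointedSplits ys ] Outer (map₁ (y ∷_) h))
    ≡⟨ cong (Outer ([] , y , ys) +_) (sym (∑-map (map₁ (y ∷_)) (pointedSplits ys) Outer)) ⟩
  Outer ([] , y , ys) + (∑[ h ← map (map₁ (y ∷_)) (pointedSplits ys) ] Outer h) ∎
  where
  open ≡-Reasoning
  Inner : List A × List A → ℕ
  Inner q = ∑[ h ← pointedSplits (proj₁ q) ] g (before h) (pivot h) (after h) (proj₂ q)
  Outer : List A × A × List A → ℕ
  Outer h = ∑[ q ← splits (after h) ] g (before h) (pivot h) (proj₁ q) (proj₂ q)

<ᵇ-true : ∀ {a b} → a < b → (a <ᵇ b) ≡ true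
<ᵇ-true {a} {b} a<b with a <ᵇ b | <⇒<ᵇ a<b
... | true | _ = refl

<ᵇ-false : ∀ {a b} → b ≤ a → (a <ᵇ b) ≡ false
<ᵇ-false {a} {b} b≤a with a <ᵇ b in eq
... | false = refl
... | true  = ⊥-elim (<⇒≱ (<ᵇ⇒< a b (subst T (sym eq) _)) b≤a)

stack-flush : ∀ m R st → All (_≤ m) st → stackGo (m ∷ R) st ≡ st ++ stackGo R (m ∷ [])
stack-flush m R []       _           = refl
stack-flush m R (t ∷ st) (t≤m ∷ st≤m) rewrite <ᵇ-false {m} {t} t≤m =
  cong (t ∷_) (stack-flush m R st st≤m)

stack-before-max : ∀ m L R st → All (_≤ m) L → All (_≤ m) st →
  stackGo (L ++ m ∷ R) st ≡ stackGo L st ++ stackGo R (m ∷ [])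
stack-before-max m []      R st       _            st≤m = stack-flush m R st st≤m
stack-before-max m (x ∷ L) R []       (x≤m ∷ L≤m) _    = stack-before-max m L R (x ∷ []) L≤m (x≤m ∷ [])
stack-before-max m (x ∷ L) R (t ∷ st) (x≤m ∷ L≤m) (t≤m ∷ st≤m)
  with x <ᵇ t | stack-before-max m (x ∷ L) R st (x≤m ∷ L≤m) st≤m
... | true  | _  = stack-before-max m L R (x ∷ t ∷ st) L≤m (x≤m ∷ t≤m ∷ st≤m)
... | false | ih = cong (t ∷_) ih

-- After m is pushed, it sits at the bottom of the stack until the very end.
stack-after-max : ∀ m R st → All (_< m) R → stackGo R (st ∷ʳ m) ≡ stackGo R st ∷ʳ m
stack-after-max m []      st       _            = refl
stack-after-max m (x ∷ R) []       (x<m ∷ R<m) rewrite <ᵇ-true x<m = stack-after-max m R (x ∷ []) R<m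
stack-after-max m (x ∷ R) (t ∷ st) (x<m ∷ R<m)
  with x <ᵇ t | stack-after-max m (x ∷ R) st (x<m ∷ R<m)
... | true  | _  = stack-after-max m R (x ∷ t ∷ st) R<m
... | false | ih = cong (t ∷_) ih

s-at-max : ∀ m L R → All (_≤ m) L → All (_< m) R → s (L ++ m ∷ R) ≡ s L ++ s R ∷ʳ m
s-at-max m L R L≤m R<m = begin
  s (L ++ m ∷ R)                  ≡⟨ stack-before-max m L R [] L≤m [] ⟩
  s L ++ stackGo R ([] ∷ʳ m)      ≡⟨ cong (s L ++_) (stack-after-max m R [] R<m) ⟩
  s L ++ s R ∷ʳ m                 ∎
  where open ≡-Reasoning

stackGo-↭ : ∀ xs st → stackGo xs st ↭ xs ++ st
stackGo-↭ []       st       = ↭-refl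
stackGo-↭ (x ∷ xs) []       = ↭-trans (stackGo-↭ xs (x ∷ [])) (shift x xs [])
stackGo-↭ (x ∷ xs) (t ∷ st) with x <ᵇ t | stackGo-↭ (x ∷ xs) st
... | true  | _  = ↭-trans (stackGo-↭ xs (x ∷ t ∷ st)) (shift x xs (t ∷ st))
... | false | ih = ↭-trans (prep t ih) (↭-sym (shift t (x ∷ xs) st))

s-↭ : ∀ xs → s xs ↭ xs
s-↭ xs = ↭-trans (stackGo-↭ xs []) (↭-reflexive (++-identityʳ xs))

insertions-sound : ∀ (x : ℕ) l {σ} → σ ∈ insertions x l → ∃₂ λ a b → σ ≡ a ++ x ∷ b × l ≡ a ++ b
insertions-sound x []       (here refl) = [] , [] , refl , refl
insertions-sound x (y ∷ ys) (here refl) = [] , y ∷ ys , refl , refl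
insertions-sound x (y ∷ ys) (there σ∈) with ∈-map⁻ (y ∷_) σ∈
... | τ , τ∈ , refl with insertions-sound x ys τ∈
... | a , b , refl , refl = y ∷ a , b , refl , refl

insertions-complete : ∀ (x : ℕ) a b → a ++ x ∷ b ∈ insertions x (a ++ b)
insertions-complete x []      []      = here refl
insertions-complete x []      (y ∷ b) = here refl
insertions-complete x (y ∷ a) b       = there (∈-map⁺ (y ∷_) (insertions-complete x a b))

insertions-unique : ∀ (x : ℕ) l → x ∉ l → Unique (insertions x l)
insertions-unique x []       _   = [] ∷ []
insertions-unique x (y ∷ ys) x∉ =
  All.tabulate first-differs ∷ Unique.map⁺ ∷-injectiveʳ (insertions-unique x ys (x∉ ∘ there))
  where
  first-differs : ∀ {τ} → τ ∈ map (y ∷_) (insertions x ys) → x ∷ y ∷ ys ≢ τ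
  first-differs τ∈ eq with ∈-map⁻ (y ∷_) τ∈
  ... | _ , _ , refl = x∉ (here (∷-injectiveˡ eq))

perms-sound : ∀ τ {σ} → σ ∈ perms τ → σ ↭ τ
perms-sound []       (here refl) = ↭-refl
perms-sound (x ∷ xs) σ∈ with ∈-concatMap⁻′ (insertions x) (perms xs) σ∈
... | l , l∈ , σ∈ins with insertions-sound x l σ∈ins
... | a , b , refl , refl = ↭-trans (shift x a b) (prep x (perms-sound xs l∈))

perms-complete : ∀ τ {σ} → σ ↭ τ → σ ∈ perms τ
perms-complete []       σ↭ rewrite ↭-empty-inv σ↭ = here refl
perms-complete (x ∷ xs) σ↭ with ∈-∃++ (∈-resp-↭ (↭-sym σ↭) (here refl))
... | a , b , refl =
  ∈-concatMap⁺′ (insertions x) (perms-complete xs (drop-mid a [] σ↭)) (insertions-complete x a b)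

perms-unique : ∀ τ → Unique τ → Unique (perms τ)
perms-unique []       _          = [] ∷ []
perms-unique (x ∷ xs) (x∉ ∷ u) =
  concatMap-unique (insertions x) (perms xs) (perms-unique xs u)
    (λ l∈ → insertions-unique x _ (x∉l l∈)) same-origin
  where
  x∉l : ∀ {l} → l ∈ perms xs → x ∉ l
  x∉l l∈ x∈l = All.lookup x∉ (∈-resp-↭ (perms-sound xs l∈) x∈l) refl
  same-origin : ∀ {l l' σ} → l ∈ perms xs → l' ∈ perms xs →
    σ ∈ insertions x l → σ ∈ insertions x l' → l ≡ l'
  same-origin {l} {l'} l∈ l'∈ σ∈ σ∈' with insertions-sound x l σ∈ | insertions-sound x l' σ∈'
  ... | a , b , refl , refl | a' , b' , eq , refl
    with ++-∷-cancel a a' (x∉l l∈ ∘ ∈-++⁺ˡ) (x∉l l'∈ ∘ ∈-++⁺ˡ) eq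
  ... | refl , refl = refl

preimages : List ℕ → List (List ℕ)
preimages τ = filter (λ σ → ≡-dec _≟_ (s σ) τ) (perms τ)

∈-preimages⁻ : ∀ τ {σ} → σ ∈ preimages τ → σ ↭ τ × s σ ≡ τ
∈-preimages⁻ τ σ∈ with ∈-filter⁻ (λ σ → ≡-dec _≟_ (s σ) τ) σ∈
... | σ∈perms , sσ≡τ = perms-sound τ σ∈perms , sσ≡τ

∈-preimages⁺ : ∀ τ {σ} → σ ↭ τ → s σ ≡ τ → σ ∈ preimages τ
∈-preimages⁺ τ σ↭τ = ∈-filter⁺ (λ σ → ≡-dec _≟_ (s σ) τ) (perms-complete τ σ↭τ)

∈-preimages-s : ∀ σ → σ ∈ preimages (s σ)
∈-preimages-s σ = ∈-preimages⁺ (s σ) (↭-sym (s-↭ σ)) refl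

preimages-unique : ∀ τ → Unique τ → Unique (preimages τ)
preimages-unique τ u = Unique.filter⁺ (λ σ → ≡-dec _≟_ (s σ) τ) (perms-unique τ u)

-- A preimage of W m is L m R with s(L) s(R) = W; so the preimages correspond to
-- the pairs (L , R) listed below, one block of pairs per factorisation W = U V.
preimagePairs : List ℕ → List (List ℕ × List ℕ)
preimagePairs W =
  concatMap (λ p → cartesianProduct (preimages (proj₁ p)) (preimages (proj₂ p))) (splits W)

∈-preimagePairs⁻ : ∀ W {L R} → (L , R) ∈ preimagePairs W → s L ++ s R ≡ W
∈-preimagePairs⁻ W LR∈ with ∈-concatMap⁻′ _ (splits W) LR∈
... | (U , V) , UV∈ , LR∈UV with ∈-cartesianProduct⁻ (preimages U) (preimages V) LR∈UV
... | L∈ , R∈ = trans (cong₂ _++_ (proj₂ (∈-preimages⁻ U L∈)) (proj₂ (∈-preimages⁻ V R∈)))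
                      (splits-sound W UV∈)

∈-preimagePairs⁺ : ∀ L R → (L , R) ∈ preimagePairs (s L ++ s R)
∈-preimagePairs⁺ L R =
  ∈-concatMap⁺′ _ (splits-complete (s L) (s R))
    (∈-cartesianProduct⁺ (∈-preimages-s L) (∈-preimages-s R))

length-preimagePairs : ∀ W →
  length (preimagePairs W) ≡ ∑[ p ← splits W ] preCount (proj₁ p) * preCount (proj₂ p)
length-preimagePairs W =
  trans (length-concatMap _ (splits W))
        (∑-cong (splits W) (λ {p} _ → length-cartesianProduct (preimages (proj₁ p)) (preimages (proj₂ p))))

module _ (W : List ℕ) (m : ℕ) (W-unique : Unique W) (W<m : All (_< m) W) where

  private
    glue : List ℕ × List ℕ → List ℕ
    glue (L , R) = L ++ m ∷ R

    below-m : ∀ L R → s L ++ s R ≡ W → All (_< m) L × All (_< m) R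
    below-m L R eq with All.++⁻ (s L) (subst (All (_< m)) (sym eq) W<m)
    ... | sL<m , sR<m = All-resp-↭ (s-↭ L) sL<m , All-resp-↭ (s-↭ R) sR<m

    m∉ : ∀ {L} → All (_< m) L → m ∉ L
    m∉ L<m m∈L = <-irrefl refl (All.lookup L<m m∈L)

    unique-factors : ∀ {p} → p ∈ splits W → Unique (proj₁ p) × Unique (proj₂ p)
    unique-factors {U , V} p∈ with splits-sound W p∈
    ... | refl = AllPairs-++⁻ U W-unique

    pairs-unique : Unique (preimagePairs W)
    pairs-unique = concatMap-unique _ (splits W) (splits-unique W) block-unique same-split
      where
      block-unique : ∀ {p} → p ∈ splits W → Unique (cartesianProduct (preimages (proj₁ p)) (preimages (proj₂ p)))
      block-unique {U , V} p∈ with unique-factors p∈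
      ... | uU , uV = Unique.cartesianProduct⁺ (preimages-unique U uU) (preimages-unique V uV)
      -- a pair (L , R) determines its block: U = s(L) and V = s(R)
      images : ∀ {p L R} → (L , R) ∈ cartesianProduct (preimages (proj₁ p)) (preimages (proj₂ p)) →
        (s L , s R) ≡ p
      images {U , V} LR∈ with ∈-cartesianProduct⁻ (preimages U) (preimages V) LR∈
      ... | L∈ , R∈ = cong₂ _,_ (proj₂ (∈-preimages⁻ U L∈)) (proj₂ (∈-preimages⁻ V R∈))
      same-split : ∀ {p q v} → p ∈ splits W → q ∈ splits W →
        v ∈ cartesianProduct (preimages (proj₁ p)) (preimages (proj₂ p)) →
        v ∈ cartesianProduct (preimages (proj₁ q)) (preimages (proj₂ q)) → p ≡ q
      same-split {v = _ , _} _ _ v∈p v∈q = trans (sym (images v∈p)) (images v∈q)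

    glue-injective : ∀ {a b} → a ∈ preimagePairs W → b ∈ preimagePairs W → glue a ≡ glue b → a ≡ b
    glue-injective {L , R} {L' , R'} a∈ b∈ eq
      with ++-∷-cancel L L' (m∉ (proj₁ (below-m L R (∈-preimagePairs⁻ W a∈))))
                            (m∉ (proj₁ (below-m L' R' (∈-preimagePairs⁻ W b∈)))) eq
    ... | refl , refl = refl

    Wm-unique : Unique (W ∷ʳ m)
    Wm-unique = Unique.++⁺ W-unique ([] ∷ []) (λ { (m∈W , here refl) → m∉ W<m m∈W })

    -- A preimage of W m contains m, so it is L m R with L, R below m; then s(L) s(R) = W.
    to : ∀ {σ} → σ ∈ preimages (W ∷ʳ m) → σ ∈ map glue (preimagePairs W)
    to {σ} σ∈ with ∈-preimages⁻ (W ∷ʳ m) σ∈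
    ... | σ↭ , sσ with ∈-∃++ (∈-resp-↭ (↭-sym σ↭) (∈-++⁺ʳ W (here refl)))
    ... | L , R , refl = subst (λ w → L ++ m ∷ R ∈ map glue (preimagePairs w)) sLsR≡W
                           (∈-map⁺ glue (∈-preimagePairs⁺ L R))
      where
      LR<m : All (_< m) (L ++ R)
      LR<m = All-resp-↭ (↭-sym (drop-mid L W σ↭)) (All.++⁺ W<m [])
      sLsR≡W : s L ++ s R ≡ W
      sLsR≡W = proj₁ (∷ʳ-injective (s L ++ s R) W (begin
        (s L ++ s R) ∷ʳ m  ≡⟨ ++-assoc (s L) (s R) (m ∷ []) ⟩
        s L ++ s R ∷ʳ m    ≡⟨ sym (s-at-max m L R (All.map <⇒≤ (All.++⁻ˡ L LR<m)) (All.++⁻ʳ L LR<m)) ⟩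
        s (L ++ m ∷ R)     ≡⟨ sσ ⟩
        W ∷ʳ m             ∎))
        where open ≡-Reasoning

    from : ∀ {σ} → σ ∈ map glue (preimagePairs W) → σ ∈ preimages (W ∷ʳ m)
    from σ∈ with ∈-map⁻ glue σ∈
    ... | (L , R) , LR∈ , refl = ∈-preimages⁺ (W ∷ʳ m) arrangement sorted
      where
      sLsR≡W : s L ++ s R ≡ W
      sLsR≡W = ∈-preimagePairs⁻ W LR∈
      arrangement : L ++ m ∷ R ↭ W ∷ʳ m
      arrangement = ↭-trans (++⁺ (↭-sym (s-↭ L)) (prep m (↭-sym (s-↭ R))))
        (↭-trans (shift m (s L) (s R))
          (↭-trans (∷↭∷ʳ m (s L ++ s R)) (↭-reflexive (cong (_∷ʳ m) sLsR≡W))))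
      sorted : s (L ++ m ∷ R) ≡ W ∷ʳ m
      sorted = trans (s-at-max m L R (All.map <⇒≤ (proj₁ (below-m L R sLsR≡W))) (proj₂ (below-m L R sLsR≡W)))
                     (trans (sym (++-assoc (s L) (s R) (m ∷ []))) (cong (_∷ʳ m) sLsR≡W))

  decomposition : preCount (W ∷ʳ m) ≡ ∑[ p ← splits W ] preCount (proj₁ p) * preCount (proj₂ p)
  decomposition = begin
    length (preimages (W ∷ʳ m))          ≡⟨ same-members⇒same-length (preimages-unique _ Wm-unique)
                                               (map-unique glue glue-injective pairs-unique) to from ⟩
    length (map glue (preimagePairs W))  ≡⟨ length-map glue (preimagePairs W) ⟩
    length (preimagePairs W)             ≡⟨ length-preimagePairs W ⟩
    ∑[ p ← splits W ] preCount (proj₁ p) * preCount (proj₂ p) ∎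
    where open ≡-Reasoning

expand-at-max : ∀ A x R M → Unique (A ++ x ∷ R) → All (_< M) (A ++ x ∷ R) →
  preCount ((A ++ x ∷ R) ∷ʳ M) ≡
    (∑[ p ← splits A ] preCount (proj₁ p) * preCount (proj₂ p ++ x ∷ R)) +
    (∑[ q ← splits R ] preCount (A ++ x ∷ proj₁ q) * preCount (proj₂ q))
expand-at-max A x R M distinct below = begin
  preCount ((A ++ x ∷ R) ∷ʳ M)
    ≡⟨ decomposition (A ++ x ∷ R) M distinct below ⟩
  ∑ (splits (A ++ x ∷ R)) f
    ≡⟨ cong (λ l → ∑ l f) (splits-++ A x R) ⟩
  ∑ (map (map₂ (_++ x ∷ R)) (splits A) ++ map (map₁ (λ U → A ++ x ∷ U)) (splits R)) f
    ≡⟨ ∑-++ (map (map₂ (_++ x ∷ R)) (splits A)) _ f ⟩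
  ∑ (map (map₂ (_++ x ∷ R)) (splits A)) f + ∑ (map (map₁ (λ U → A ++ x ∷ U)) (splits R)) f
    ≡⟨ cong₂ _+_ (∑-map (map₂ (_++ x ∷ R)) (splits A) f) (∑-map (map₁ (λ U → A ++ x ∷ U)) (splits R) f) ⟩
  (∑[ p ← splits A ] preCount (proj₁ p) * preCount (proj₂ p ++ x ∷ R)) +
  (∑[ q ← splits R ] preCount (A ++ x ∷ proj₁ q) * preCount (proj₂ q)) ∎
  where
  open ≡-Reasoning
  f : List ℕ × List ℕ → ℕ
  f p = preCount (proj₁ p) * preCount (proj₂ p)

-- The vanishing lemma: s(σ) always ends with the largest entry of σ, so W y has no
-- preimage as soon as some entry of W exceeds y.
max-factor : ∀ (y : ℕ) ys → ∃ λ L → ∃₂ λ M R → y ∷ ys ≡ L ++ M ∷ R × All (_≤ M) L × All (_< M) R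
max-factor y []       = [] , y , [] , refl , [] , []
max-factor y (z ∷ zs) with max-factor z zs
... | L , M , R , eq , L≤M , R<M with y ≤? M
...   | yes y≤M = y ∷ L , M , R , cong (y ∷_) eq , y≤M ∷ L≤M , R<M
...   | no  y≰M = [] , y , z ∷ zs , refl , [] ,
        subst (All (_< y)) (sym eq) (All.++⁺ (All.map (λ v≤M → ≤-<-trans v≤M M<y) L≤M)
                                             (M<y ∷ All.map (λ v<M → <-trans v<M M<y) R<M))
  where
  M<y : M < y
  M<y = ≰⇒> y≰M

vanishing : ∀ W y {z} → z ∈ W → y < z → preCount (W ∷ʳ y) ≡ 0
vanishing W y {z} z∈W y<z = no-members (preimages (W ∷ʳ y)) not-a-preimage
  where
  no-members : ∀ (xs : List (List ℕ)) → (∀ {σ} → σ ∉ xs) → length xs ≡ 0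
  no-members []      _ = refl
  no-members (σ ∷ _) h = ⊥-elim (h (here refl))
  not-a-preimage : ∀ {σ} → σ ∉ preimages (W ∷ʳ y)
  not-a-preimage {σ} σ∈ with ∈-preimages⁻ (W ∷ʳ y) σ∈
  ... | σ↭ , sσ with σ | ∈-resp-↭ (↭-sym σ↭) (∈-++⁺ˡ z∈W)
  ... | v ∷ vs | z∈σ with max-factor v vs
  ... | L , M , R , σ≡ , L≤M , R<M = <⇒≱ y<z (subst (z ≤_) M≡y z≤M)
    where
    z≤M : z ≤ M
    z≤M = All.lookup (subst (All (_≤ M)) (sym σ≡) (All.++⁺ L≤M (≤-refl ∷ All.map <⇒≤ R<M))) z∈σ
    M≡y : M ≡ y
    M≡y = proj₂ (∷ʳ-injective (s L ++ s R) W (begin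
      (s L ++ s R) ∷ʳ M  ≡⟨ ++-assoc (s L) (s R) (M ∷ []) ⟩
      s L ++ s R ∷ʳ M    ≡⟨ sym (s-at-max M L R L≤M R<M) ⟩
      s (L ++ M ∷ R)     ≡⟨ cong s (sym σ≡) ⟩
      s (v ∷ vs)         ≡⟨ sσ ⟩
      W ∷ʳ y             ∎))
      where open ≡-Reasoning

vanishing-below : ∀ A x B → B ≢ [] → All (_< x) B → preCount (A ++ x ∷ B) ≡ 0
vanishing-below A x B B≢[] B<x with snoc-view B
... | inj₁ B≡[]              = ⊥-elim (B≢[] B≡[])
... | inj₂ (B₀ , y , refl) =
  trans (cong preCount (sym (++-assoc A (x ∷ B₀) (y ∷ []))))
        (vanishing (A ++ x ∷ B₀) y (∈-++⁺ʳ A (here refl)) (All.lookup B<x (∈-++⁺ʳ B₀ (here refl))))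

cut-after-B : ∀ A x B T → B ≢ [] → All (_< x) B →
  ∑[ q ← splits (B ++ T) ] preCount (A ++ x ∷ proj₁ q) * preCount (proj₂ q) ≡
    preCount (A ++ x ∷ []) * preCount (B ++ T) +
    (∑[ q ← splits T ] preCount (A ++ x ∷ B ++ proj₁ q) * preCount (proj₂ q))
cut-after-B A x B T B≢[] B<x with snoc-view B
... | inj₁ B≡[]            = ⊥-elim (B≢[] B≡[])
... | inj₂ (B₀ , b , refl) = begin
  ∑ (splits ((B₀ ∷ʳ b) ++ T)) F
    ≡⟨ cong (λ l → ∑ (splits l) F) (++-assoc B₀ (b ∷ []) T) ⟩
  ∑ (splits (B₀ ++ b ∷ T)) F
    ≡⟨ cong (λ l → ∑ l F) (splits-++ B₀ b T) ⟩
  ∑ (map (map₂ (_++ b ∷ T)) (splits B₀) ++ map (map₁ (λ U → B₀ ++ b ∷ U)) (splits T)) F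
    ≡⟨ ∑-++ (map (map₂ (_++ b ∷ T)) (splits B₀)) _ F ⟩
  ∑ (map (map₂ (_++ b ∷ T)) (splits B₀)) F + ∑ (map (map₁ (λ U → B₀ ++ b ∷ U)) (splits T)) F
    ≡⟨ cong₂ _+_ (∑-map (map₂ (_++ b ∷ T)) (splits B₀) F) (∑-map (map₁ (λ U → B₀ ++ b ∷ U)) (splits T) F) ⟩
  (∑[ p ← splits B₀ ] F (proj₁ p , proj₂ p ++ b ∷ T)) + (∑[ q ← splits T ] F (B₀ ++ b ∷ proj₁ q , proj₂ q))
    ≡⟨ cong₂ _+_ (∑-splits-first B₀ (λ p → F (proj₁ p , proj₂ p ++ b ∷ T)) inside-B)
                 (∑-cong (splits T) (λ {q} _ → cong (λ l → preCount (A ++ x ∷ l) * preCount (proj₂ q))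
                                                    (sym (++-assoc B₀ (b ∷ []) (proj₁ q))))) ⟩
  F ([] , B₀ ++ b ∷ T) + (∑[ q ← splits T ] preCount (A ++ x ∷ (B₀ ∷ʳ b) ++ proj₁ q) * preCount (proj₂ q))
    ≡⟨ cong (λ l → preCount (A ++ x ∷ []) * preCount l + (∑[ q ← splits T ] F ((B₀ ∷ʳ b) ++ proj₁ q , proj₂ q)))
            (sym (++-assoc B₀ (b ∷ []) T)) ⟩
  preCount (A ++ x ∷ []) * preCount ((B₀ ∷ʳ b) ++ T) +
    (∑[ q ← splits T ] preCount (A ++ x ∷ (B₀ ∷ʳ b) ++ proj₁ q) * preCount (proj₂ q)) ∎
  where
  open ≡-Reasoning
  F : List ℕ × List ℕ → ℕ
  F q = preCount (A ++ x ∷ proj₁ q) * preCount (proj₂ q)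
  inside-B : ∀ {p} → p ∈ splits B₀ → proj₁ p ≢ [] → F (proj₁ p , proj₂ p ++ b ∷ T) ≡ 0
  inside-B {U , V} p∈ U≢[] =
    cong (_* preCount (V ++ b ∷ T))
      (vanishing-below A x U U≢[] (All.++⁻ˡ U (subst (All (_< x)) (sym (splits-sound B₀ p∈)) (All.++⁻ˡ B₀ B<x))))

Sorted : List ℕ → Set
Sorted = AllPairs _<_

Above : List ℕ → List ℕ → Set
Above L T = All (λ t → All (_< t) L) T

unique-++-above : ∀ {L T} → Unique L → Sorted T → Above L T → Unique (L ++ T)
unique-++-above L-unique T-sorted T-above =
  Unique.++⁺ L-unique (AllPairs.map <⇒≢ T-sorted)
    (λ (v∈L , v∈T) → <-irrefl refl (All.lookup (All.lookup T-above v∈T) v∈L))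

sorted-∷ʳ : ∀ T {M} → Sorted (T ∷ʳ M) → Sorted T × All (_< M) T
sorted-∷ʳ []      _             = [] , []
sorted-∷ʳ (t ∷ T) (t<rest ∷ sorted) with sorted-∷ʳ T sorted
... | T-sorted , T<M = All.++⁻ˡ T t<rest ∷ T-sorted , All.head (All.++⁻ʳ T t<rest) ∷ T<M

All-after : ∀ {P : ℕ → Set} T {h} → h ∈ pointedSplits T → All P T → All P (after h)
All-after T {h₁ , t , h₃} h∈ all rewrite pointedSplits-sound T h∈ = All.tail (All.++⁻ʳ h₁ all)

Sorted-after : ∀ T {h} → h ∈ pointedSplits T → Sorted T → Sorted (after h)
Sorted-after T {h₁ , t , h₃} h∈ sorted rewrite pointedSplits-sound T h∈ =
  AllPairs.tail (proj₂ (AllPairs-++⁻ h₁ sorted))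

below-last : ∀ L T {M} → Unique L → Sorted (T ∷ʳ M) → Above L (T ∷ʳ M) →
  Unique (L ++ T) × All (_< M) (L ++ T)
below-last L T L-unique TM-sorted TM-above =
  let T-sorted , T<M = sorted-∷ʳ T TM-sorted in
  unique-++-above L-unique T-sorted (All.++⁻ˡ T TM-above) , All.++⁺ (All.head (All.++⁻ʳ T TM-above)) T<M

module _ (x : ℕ) (B : List ℕ) where

  hookSum : List ℕ → List ℕ → ℕ
  hookSum A T = ∑[ h ← pointedSplits T ] preCount (A ++ x ∷ after h) * preCount (B ++ before h)

  -- The two rearrangements of double sums in the inductive step, given the identity for
  -- the smaller instances: cuts inside A, and cuts inside T.
  left-cuts : ∀ A T → (∀ {p} → p ∈ splits A → preCount (proj₂ p ++ x ∷ B ++ T) ≡ hookSum (proj₂ p) T) →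
    ∑[ p ← splits A ] preCount (proj₁ p) * preCount (proj₂ p ++ x ∷ B ++ T) ≡
    ∑[ h ← pointedSplits T ] (∑[ p ← splits A ] preCount (proj₁ p) * preCount (proj₂ p ++ x ∷ after h)) * preCount (B ++ before h)
  left-cuts A T ih =
    trans (∑-cong (splits A) (λ {p} p∈ → cong (preCount (proj₁ p) *_) (ih p∈)))
          (∑-factor-swap (splits A) (pointedSplits T) (preCount ∘ proj₁)
                         (λ p h → preCount (proj₂ p ++ x ∷ after h)) (λ h → preCount (B ++ before h)))

  right-cuts : ∀ A T → (∀ {q} → q ∈ splits T → preCount (A ++ x ∷ B ++ proj₁ q) ≡ hookSum A (proj₁ q)) →
    ∑[ q ← splits T ] preCount (A ++ x ∷ B ++ proj₁ q) * preCount (proj₂ q) ≡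
    ∑[ h ← pointedSplits T ] (∑[ q ← splits (after h) ] preCount (A ++ x ∷ proj₁ q) * preCount (proj₂ q)) * preCount (B ++ before h)
  right-cuts A T ih = begin
    ∑[ q ← splits T ] preCount (A ++ x ∷ B ++ proj₁ q) * preCount (proj₂ q)
      ≡⟨ ∑-cong (splits T) (λ {q} q∈ → cong (_* preCount (proj₂ q)) (ih q∈)) ⟩
    ∑[ q ← splits T ] hookSum A (proj₁ q) * preCount (proj₂ q)
      ≡⟨ ∑-cong (splits T) (λ {q} _ → ∑-*ʳ (preCount (proj₂ q)) (pointedSplits (proj₁ q)) _) ⟩
    ∑[ q ← splits T ] ∑[ h ← pointedSplits (proj₁ q) ] E (after h) * D (before h) * preCount (proj₂ q)
      ≡⟨ ∑-splits-pointedSplits (λ h₁ _ h₃ v → E h₃ * D h₁ * preCount v) T ⟩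
    ∑[ h ← pointedSplits T ] ∑[ q ← splits (after h) ] E (proj₁ q) * D (before h) * preCount (proj₂ q)
      ≡⟨ ∑-cong (pointedSplits T) (λ {h} _ → ∑-cong (splits (after h)) (λ {q} _ →
           *-swapʳ (E (proj₁ q)) (D (before h)) (preCount (proj₂ q)))) ⟩
    ∑[ h ← pointedSplits T ] ∑[ q ← splits (after h) ] E (proj₁ q) * preCount (proj₂ q) * D (before h)
      ≡⟨ ∑-cong (pointedSplits T) (λ {h} _ → sym (∑-*ʳ (D (before h)) (splits (after h)) _)) ⟩
    ∑[ h ← pointedSplits T ] (∑[ q ← splits (after h) ] E (proj₁ q) * preCount (proj₂ q)) * D (before h) ∎
    where
    open ≡-Reasoning
    E D : List ℕ → ℕ
    E P = preCount (A ++ x ∷ P)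
    D P = preCount (B ++ P)

  record Admissible (A T : List ℕ) : Set where
    field
      distinct : Unique (A ++ x ∷ B)
      sorted   : Sorted T
      above    : Above (A ++ x ∷ B) T

  open Admissible

  admissible-suffix : ∀ A₁ A₂ {T} → Admissible (A₁ ++ A₂) T → Admissible A₂ T
  admissible-suffix A₁ A₂ adm = record
    { distinct = proj₂ (AllPairs-++⁻ A₁ (subst Unique (++-assoc A₁ A₂ (x ∷ B)) (distinct adm)))
    ; sorted   = sorted adm
    ; above    = All.map (λ {t} → All.++⁻ʳ A₁ ∘ subst (All (_< t)) (++-assoc A₁ A₂ (x ∷ B))) (above adm)
    }

  admissible-prefix : ∀ A T₁ {T₂} → Admissible A (T₁ ++ T₂) → Admissible A T₁
  admissible-prefix A T₁ adm = record
    { distinct = distinct adm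
    ; sorted   = proj₁ (AllPairs-++⁻ T₁ (sorted adm))
    ; above    = All.++⁻ˡ T₁ (above adm)
    }

  without-B : ∀ {P : ℕ → Set} A → All P (A ++ x ∷ B) → All P (A ++ x ∷ [])
  without-B A all = All.++⁺ (All.++⁻ˡ A all) (All.head (All.++⁻ʳ A all) ∷ [])

  expand-hookSum : ∀ A T M → Admissible A (T ∷ʳ M) →
    hookSum A (T ∷ʳ M) ≡
      (∑[ h ← pointedSplits T ] (∑[ p ← splits A ] preCount (proj₁ p) * preCount (proj₂ p ++ x ∷ after h)) * preCount (B ++ before h)) +
      (∑[ h ← pointedSplits T ] (∑[ q ← splits (after h) ] preCount (A ++ x ∷ proj₁ q) * preCount (proj₂ q)) * preCount (B ++ before h)) +
      preCount (A ++ x ∷ []) * preCount (B ++ T)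
  expand-hookSum A T M adm =
    trans (∑-pointedSplits-∷ʳ T M (λ h → preCount (A ++ x ∷ after h) * D h))
          (cong (_+ preCount (A ++ x ∷ []) * preCount (B ++ T))
            (trans (∑-cong (pointedSplits T) (λ {h} h∈ → trans (cong (_* D h) (expand h∈)) (*-distribʳ-+ (D h) (X h) (Y h))))
                   (∑-+ (pointedSplits T) (λ h → X h * D h) (λ h → Y h * D h))))
    where
    X Y D : List ℕ × ℕ × List ℕ → ℕ
    X h = ∑[ p ← splits A ] preCount (proj₁ p) * preCount (proj₂ p ++ x ∷ after h)
    Y h = ∑[ q ← splits (after h) ] preCount (A ++ x ∷ proj₁ q) * preCount (proj₂ q)
    D h = preCount (B ++ before h)
    Ax-unique : Unique (A ++ x ∷ [])
    Ax-unique = proj₁ (AllPairs-++⁻ (A ++ x ∷ []) (subst Unique (sym (++-assoc A (x ∷ []) B)) (distinct adm)))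
    expand : ∀ {h} → h ∈ pointedSplits T → preCount (A ++ x ∷ after h ∷ʳ M) ≡ X h + Y h
    expand {h} h∈ =
      let h∈TM = pointedSplits-∷ʳ⁺ T M h∈
          Axh-unique , Axh<M = below-last (A ++ x ∷ []) (after h) Ax-unique (Sorted-after (T ∷ʳ M) h∈TM (sorted adm))
                                 (All.map (without-B A) (All-after (T ∷ʳ M) h∈TM (above adm)))
      in trans (cong preCount (sym (++-assoc A (x ∷ after h) (M ∷ []))))
               (expand-at-max A x (after h) M (subst Unique (++-assoc A (x ∷ []) (after h)) Axh-unique)
                                              (subst (All (_< M)) (++-assoc A (x ∷ []) (after h)) Axh<M))

  module _ (B≢[] : B ≢ []) (B<x : All (_< x) B) where

    -- One step of the induction: peel off the last (largest) entry M of the run.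
    inductive-step : ∀ A T M →
      (∀ A′ T′ → length T′ ≤ length T → Admissible A′ T′ → preCount (A′ ++ x ∷ B ++ T′) ≡ hookSum A′ T′) →
      Admissible A (T ∷ʳ M) → preCount (A ++ x ∷ B ++ T ∷ʳ M) ≡ hookSum A (T ∷ʳ M)
    inductive-step A T M ih adm = begin
      preCount (A ++ x ∷ B ++ T ∷ʳ M)
        ≡⟨ cong preCount reassociate ⟩
      preCount ((A ++ x ∷ B ++ T) ∷ʳ M)
        ≡⟨ expand-at-max A x (B ++ T) M (subst Unique AxB-T (proj₁ AxBT-facts)) (subst (All (_< M)) AxB-T (proj₂ AxBT-facts)) ⟩
      S₁ + (∑[ q ← splits (B ++ T) ] preCount (A ++ x ∷ proj₁ q) * preCount (proj₂ q))
        ≡⟨ cong (S₁ +_) (cut-after-B A x B T B≢[] B<x) ⟩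
      S₁ + (E₀ + S₃)
        ≡⟨ cong₂ (λ a b → a + (E₀ + b)) (left-cuts A T ih-suffix) (right-cuts A T ih-prefix) ⟩
      R₁ + (E₀ + R₃)
        ≡⟨ x∙yz≈xz∙y R₁ E₀ R₃ ⟩
      R₁ + R₃ + E₀
        ≡⟨ sym (expand-hookSum A T M adm) ⟩
      hookSum A (T ∷ʳ M) ∎
      where
      open ≡-Reasoning
      -- S₁ and R₁ collect the cuts inside A, S₃ and R₃ those inside T, E₀ the cut after x.
      E₀ S₁ S₃ R₁ R₃ : ℕ
      E₀ = preCount (A ++ x ∷ []) * preCount (B ++ T)
      S₁ = ∑[ p ← splits A ] preCount (proj₁ p) * preCount (proj₂ p ++ x ∷ B ++ T)
      S₃ = ∑[ q ← splits T ] preCount (A ++ x ∷ B ++ proj₁ q) * preCount (proj₂ q)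
      R₁ = ∑[ h ← pointedSplits T ] (∑[ p ← splits A ] preCount (proj₁ p) * preCount (proj₂ p ++ x ∷ after h)) * preCount (B ++ before h)
      R₃ = ∑[ h ← pointedSplits T ] (∑[ q ← splits (after h) ] preCount (A ++ x ∷ proj₁ q) * preCount (proj₂ q)) * preCount (B ++ before h)
      reassociate : A ++ x ∷ B ++ T ∷ʳ M ≡ (A ++ x ∷ B ++ T) ∷ʳ M
      reassociate = trans (cong (λ l → A ++ x ∷ l) (sym (++-assoc B T (M ∷ [])))) (sym (++-assoc A (x ∷ B ++ T) (M ∷ [])))
      adm-T : Admissible A T
      adm-T = admissible-prefix A T adm
      AxB-T : (A ++ x ∷ B) ++ T ≡ A ++ x ∷ B ++ T
      AxB-T = ++-assoc A (x ∷ B) T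
      AxBT-facts : Unique ((A ++ x ∷ B) ++ T) × All (_< M) ((A ++ x ∷ B) ++ T)
      AxBT-facts = below-last (A ++ x ∷ B) T (distinct adm) (sorted adm) (above adm)
      ih-suffix : ∀ {p} → p ∈ splits A → preCount (proj₂ p ++ x ∷ B ++ T) ≡ hookSum (proj₂ p) T
      ih-suffix {A₁ , A₂} p∈ =
        ih A₂ T ≤-refl (admissible-suffix A₁ A₂ (subst (λ a → Admissible a T) (sym (splits-sound A p∈)) adm-T))
      ih-prefix : ∀ {q} → q ∈ splits T → preCount (A ++ x ∷ B ++ proj₁ q) ≡ hookSum A (proj₁ q)
      ih-prefix {T₁ , T₂} q∈ =
        ih A T₁ (splits-length T q∈) (admissible-prefix A T₁ (subst (Admissible A) (sym (splits-sound T q∈)) adm-T))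

    -- For T empty both sides vanish, A x B having no preimage.
    main-identity-≤ : ∀ n A T → length T ≤ n → Admissible A T → preCount (A ++ x ∷ B ++ T) ≡ hookSum A T
    main-identity-≤ n A T len adm with snoc-view T
    ... | inj₁ refl =
      trans (cong (λ l → preCount (A ++ x ∷ l)) (++-identityʳ B)) (vanishing-below A x B B≢[] B<x)
    main-identity-≤ zero    A _ len adm | inj₂ (T , M , refl) = ⊥-elim (<⇒≱ (s≤s z≤n) (subst (_≤ _) (length-∷ʳ T M) len))
    main-identity-≤ (suc n) A _ len adm | inj₂ (T , M , refl) =
      inductive-step A T M
        (λ A′ T′ T′≤T → main-identity-≤ n A′ T′ (≤-trans T′≤T (s≤s⁻¹ (subst (_≤ _) (length-∷ʳ T M) len)))) adm

    main-identity : ∀ A T → Admissible A T → preCount (A ++ x ∷ B ++ T) ≡ hookSum A T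
    main-identity A T = main-identity-≤ (length T) A T ≤-refl

take-length : ∀ (P R : List ℕ) → take (length P) (P ++ R) ≡ P
take-length []      R = refl
take-length (p ∷ P) R = cong (p ∷_) (take-length P R)

take-++ : ∀ (P R : List ℕ) i → take (length P + i) (P ++ R) ≡ P ++ take i R
take-++ []      R i = refl
take-++ (p ∷ P) R i = cong (p ∷_) (take-++ P R i)

drop-length : ∀ (P R : List ℕ) → drop (length P) (P ++ R) ≡ R
drop-length []      R = refl
drop-length (p ∷ P) R = drop-length P R

drop-++ : ∀ (P R : List ℕ) i → drop (suc (length P + i)) (P ++ R) ≡ drop (suc i) R
drop-++ []      R i = refl
drop-++ (p ∷ P) R i = drop-++ P R i

at-++ : ∀ (P R : List ℕ) i → at (P ++ R) (suc (length P + i)) ≡ at R (suc i)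
at-++ []          R i = refl
at-++ (p ∷ [])    R i = refl
at-++ (p ∷ q ∷ P) R i = at-++ (q ∷ P) R i

at-after : ∀ (P R : List ℕ) → at (P ++ R) (suc (length P)) ≡ at R 1
at-after P R = trans (cong (λ k → at (P ++ R) (suc k)) (sym (+-identityʳ (length P)))) (at-++ P R 0)

-- The pointed split of R at (0-based) position i.
pointAt : List ℕ → ℕ → List ℕ × ℕ × List ℕ
pointAt R i = take i R , at R (suc i) , drop (suc i) R

pointedSplits-by-position : ∀ R → pointedSplits R ≡ map (pointAt R) (upTo (length R))
pointedSplits-by-position []      = refl
pointedSplits-by-position (r ∷ R) = cong (([] , r , R) ∷_) (begin
  map (map₁ (r ∷_)) (pointedSplits R)                  ≡⟨ cong (map (map₁ (r ∷_))) (pointedSplits-by-position R) ⟩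
  map (map₁ (r ∷_)) (map (pointAt R) (upTo (length R))) ≡⟨ cong (map (map₁ (r ∷_))) (map-applyUpTo id (pointAt R) (length R)) ⟩
  map (map₁ (r ∷_)) (applyUpTo (pointAt R) (length R))  ≡⟨ map-applyUpTo (pointAt R) (map₁ (r ∷_)) (length R) ⟩
  applyUpTo (pointAt (r ∷ R) ∘ suc) (length R)          ≡⟨ sym (map-applyUpTo suc (pointAt (r ∷ R)) (length R)) ⟩
  map (pointAt (r ∷ R)) (applyUpTo suc (length R))       ∎)
  where open ≡-Reasoning

-- For π = P R with P ending in x, the hooks (|P| , j) are the pointed splits of R
-- whose singled-out entry exceeds x.
hooks-as-pointedSplits : ∀ (P R : List ℕ) x → at (P ++ R) (length P) ≡ x →
  sum (map (λ j → preCount (πU (P ++ R) (length P) j) * preCount (πS (P ++ R) (length P) j)) (SW (P ++ R) (length P)))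
  ≡ ∑[ h ← pointedSplits R ] when (x <? pivot h) (preCount (P ++ after h) * preCount (before h))
hooks-as-pointedSplits P R x at-d≡x = begin
  ∑ (filter (λ j → at π d <? at π j) (range (suc d) (length π))) G
    ≡⟨ ∑-filter (λ j → at π d <? at π j) (range (suc d) (length π)) G ⟩
  ∑[ j ← map (suc d +_) (upTo (length π ∸ d)) ] when (at π d <? at π j) (G j)
    ≡⟨ ∑-map (suc d +_) (upTo (length π ∸ d)) _ ⟩
  ∑[ i ← upTo (length π ∸ d) ] when (at π d <? at π (suc d + i)) (G (suc d + i))
    ≡⟨ cong (λ k → ∑[ i ← upTo k ] when (at π d <? at π (suc d + i)) (G (suc d + i))) length-R ⟩
  ∑[ i ← upTo (length R) ] when (at π d <? at π (suc d + i)) (G (suc d + i))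
    ≡⟨ ∑-cong (upTo (length R)) (λ {i} _ → term i) ⟩
  ∑[ i ← upTo (length R) ] φ (pointAt R i)
    ≡⟨ sym (∑-map (pointAt R) (upTo (length R)) φ) ⟩
  ∑ (map (pointAt R) (upTo (length R))) φ
    ≡⟨ cong (λ l → ∑ l φ) (sym (pointedSplits-by-position R)) ⟩
  ∑ (pointedSplits R) φ ∎
  where
  open ≡-Reasoning
  π : List ℕ
  π = P ++ R
  d : ℕ
  d = length P
  G : ℕ → ℕ
  G j = preCount (πU π d j) * preCount (πS π d j)
  φ : List ℕ × ℕ × List ℕ → ℕ
  φ h = when (x <? pivot h) (preCount (P ++ after h) * preCount (before h))
  length-R : length π ∸ d ≡ length R
  length-R = trans (cong (_∸ d) (length-++ P)) (m+n∸m≡n d (length R))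
  term : ∀ i → when (at π d <? at π (suc d + i)) (G (suc d + i)) ≡ φ (pointAt R i)
  term i rewrite at-d≡x | at-++ P R i | take-length P R | drop-++ P R i | take-++ P R i | drop-length P (take i R) = refl

at-marked : ∀ A (x : ℕ) R → at ((A ∷ʳ x) ++ R) (length (A ∷ʳ x)) ≡ x
at-marked []          x R = refl
at-marked (a ∷ [])    x R = refl
at-marked (a ∷ a′ ∷ A) x R = at-marked (a′ ∷ A) x R

hookTotal : List ℕ → ℕ → ℕ
hookTotal π d = sum (map (λ j → preCount (πU π d j) * preCount (πS π d j)) (SW π d))

hookTotal-at-x : ∀ A x B T → All (_< x) B → All (x <_) T →
  hookTotal (A ++ x ∷ B ++ T) (suc (length A)) ≡ hookSum x B A T
hookTotal-at-x A x B T B<x x<T = begin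
  hookTotal (A ++ x ∷ B ++ T) (suc (length A))
    ≡⟨ cong₂ hookTotal (sym (++-assoc A (x ∷ []) (B ++ T))) (sym (length-∷ʳ A x)) ⟩
  hookTotal ((A ∷ʳ x) ++ B ++ T) (length (A ∷ʳ x))
    ≡⟨ hooks-as-pointedSplits (A ∷ʳ x) (B ++ T) x (at-marked A x (B ++ T)) ⟩
  ∑ (pointedSplits (B ++ T)) φ
    ≡⟨ cong (λ l → ∑ l φ) (pointedSplits-++ B T) ⟩
  ∑ (map (map₂ (map₂ (_++ T))) (pointedSplits B) ++ map (map₁ (B ++_)) (pointedSplits T)) φ
    ≡⟨ ∑-++ (map (map₂ (map₂ (_++ T))) (pointedSplits B)) _ φ ⟩
  ∑ (map (map₂ (map₂ (_++ T))) (pointedSplits B)) φ + ∑ (map (map₁ (B ++_)) (pointedSplits T)) φ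
    ≡⟨ cong₂ _+_ (∑-map (map₂ (map₂ (_++ T))) (pointedSplits B) φ) (∑-map (map₁ (B ++_)) (pointedSplits T) φ) ⟩
  ∑ (pointedSplits B) (φ ∘ map₂ (map₂ (_++ T))) + ∑ (pointedSplits T) (φ ∘ map₁ (B ++_))
    ≡⟨ cong₂ _+_ (∑-zero (pointedSplits B) pivot-in-B) (∑-cong (pointedSplits T) pivot-in-T) ⟩
  0 + hookSum x B A T ∎
  where
  open ≡-Reasoning
  φ : List ℕ × ℕ × List ℕ → ℕ
  φ h = when (x <? pivot h) (preCount ((A ∷ʳ x) ++ after h) * preCount (before h))
  pivot-in-B : ∀ {h} → h ∈ pointedSplits B → φ (map₂ (map₂ (_++ T)) h) ≡ 0
  pivot-in-B {h} h∈ with x <? pivot h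
  ... | yes x<t = ⊥-elim (<-asym x<t (All.lookup B<x (pivot-∈ B h∈)))
  ... | no  _   = refl
  pivot-in-T : ∀ {h} → h ∈ pointedSplits T →
    φ (map₁ (B ++_) h) ≡ preCount (A ++ x ∷ after h) * preCount (B ++ before h)
  pivot-in-T {h} h∈ with x <? pivot h
  ... | yes _   = cong (λ l → preCount l * preCount (B ++ before h)) (++-assoc A (x ∷ []) (after h))
  ... | no  x≮t = ⊥-elim (x≮t (All.lookup x<T (pivot-∈ T h∈)))

Sₙ-unique : ∀ {n π} → InS n π → Unique π
Sₙ-unique {n} π∈Sₙ = Unique-resp-↭ (↭⇒↭ₛ (↭-sym π∈Sₙ)) (Unique.map⁺ suc-injective (Unique.upTo⁺ n))

Sₙ-bounded : ∀ {n π v} → InS n π → v ∈ π → v ≤ length π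
Sₙ-bounded {n} {π} π∈Sₙ v∈π with ∈-map⁻ suc (∈-resp-↭ π∈Sₙ v∈π)
... | i , i∈ , refl = subst (suc i ≤_) (sym length-π) (∈-upTo⁻ i∈)
  where
  length-π : length π ≡ n
  length-π = trans (↭-length π∈Sₙ) (trans (length-map suc (upTo n)) (length-upTo n))

unique-disjoint : ∀ (L : List ℕ) {T v} → Unique (L ++ T) → v ∈ L → v ∉ T
unique-disjoint (a ∷ L) (a∉ ∷ _) (here refl) v∈T = All.lookup a∉ (∈-++⁺ʳ L v∈T) refl
unique-disjoint (a ∷ L) (_ ∷ u)  (there v∈L) v∈T = unique-disjoint L u v∈L v∈T

list-ext : ∀ (xs ys : List ℕ) → length xs ≡ length ys →
  (∀ i → i < length xs → at xs (suc i) ≡ at ys (suc i)) → xs ≡ ys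
list-ext []       []       _   _ = refl
list-ext (x ∷ xs) (y ∷ ys) len h =
  cong₂ _∷_ (h 0 (s≤s z≤n)) (list-ext xs ys (suc-injective len) (λ i i< → h (suc i) (s≤s i<)))

at-applyUpTo : ∀ (f : ℕ → ℕ) k i → i < k → at (applyUpTo f k) (suc i) ≡ f i
at-applyUpTo f (suc k) zero    _       = refl
at-applyUpTo f (suc k) (suc i) (s≤s i<k) = at-applyUpTo (f ∘ suc) k i i<k

tail-fixed : ∀ (π : List ℕ) k m → k ∸ tlAux π k + 1 ≤ m → m ≤ k → at π m ≡ m
tail-fixed π zero    m lo hi = ⊥-elim (<⇒≱ lo hi)
tail-fixed π (suc k) m lo hi with at π (suc k) ≟ suc k
... | no  _ = ⊥-elim (<⇒≱ (subst (_≤ m) (+-comm (suc k) 1) lo) hi)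
... | yes fixed with m ≟ suc k
...   | yes refl = fixed
...   | no  m≢k  = tail-fixed π k m lo (s≤s⁻¹ (≤∧≢⇒< hi m≢k))

-- If the entry right after L lies in the tail of π = L T, then T is the run
-- |L|+1, |L|+2, …, n; in particular it is increasing and lies above every entry of L.
tail-run : ∀ {n} L T → InS n (L ++ T) → InTail (L ++ T) (suc (length L)) → Sorted T × Above L T
tail-run L T π∈Sₙ (tail-start , _ , _) = T-sorted , T-above
  where
  j₀ : ℕ
  j₀ = suc (length L)
  length-π : length (L ++ T) ≡ length L + length T
  length-π = length-++ L
  T≡run : T ≡ applyUpTo (j₀ +_) (length T)
  T≡run = list-ext T (applyUpTo (j₀ +_) (length T)) (sym (length-applyUpTo (j₀ +_) (length T))) λ i i< →
    begin
      at T (suc i)                         ≡⟨ sym (at-++ L T i) ⟩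
      at (L ++ T) (j₀ + i)                 ≡⟨ tail-fixed (L ++ T) (length (L ++ T)) (j₀ + i)
                                                (≤-trans tail-start (m≤m+n j₀ i))
                                                (subst₂ _≤_ (+-suc (length L) i) (sym length-π) (+-monoʳ-≤ (length L) i<)) ⟩
      j₀ + i                               ≡⟨ sym (at-applyUpTo (j₀ +_) (length T) i i<) ⟩
      at (applyUpTo (j₀ +_) (length T)) (suc i) ∎
    where open ≡-Reasoning
  T-sorted : Sorted T
  T-sorted = subst Sorted (sym T≡run)
    (AllPairs.applyUpTo⁺₁ (j₀ +_) (length T) (λ i<j _ → +-monoʳ-< j₀ i<j))
  T≥j₀ : ∀ {t} → t ∈ T → j₀ ≤ t
  T≥j₀ t∈T with ∈-applyUpTo⁻ (j₀ +_) (subst (_ ∈_) T≡run t∈T)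
  ... | i , _ , refl = m≤m+n j₀ i
  -- an entry v ≥ j₀ of L would be one of j₀, …, n, i.e. an entry of T
  L<j₀ : ∀ {v} → v ∈ L → v < j₀
  L<j₀ {v} v∈L with j₀ ≤? v
  ... | no  v≱j₀ = ≰⇒> v≱j₀
  ... | yes j₀≤v = ⊥-elim (unique-disjoint L (Sₙ-unique π∈Sₙ) v∈L v∈T)
    where
    v<end : v ∸ j₀ < length T
    v<end = subst (v ∸ j₀ <_) (m+n∸m≡n j₀ (length T))
              (∸-monoˡ-< (s≤s (subst (v ≤_) length-π (Sₙ-bounded π∈Sₙ (∈-++⁺ˡ v∈L)))) j₀≤v)
    v∈T : v ∈ T
    v∈T = subst (v ∈_) (sym T≡run) (subst (_∈ applyUpTo (j₀ +_) (length T)) (m+[n∸m]≡n j₀≤v)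
                                       (∈-applyUpTo⁺ (j₀ +_) v<end))
  T-above : Above L T
  T-above = All.tabulate (λ t∈T → All.tabulate (λ v∈L → <-≤-trans (L<j₀ v∈L) (T≥j₀ t∈T)))

split-at : ∀ (xs : List ℕ) i → i < length xs → ∃ λ A → ∃₂ λ x R → xs ≡ A ++ x ∷ R × length A ≡ i
split-at (y ∷ ys) zero    _         = [] , y , ys , refl , refl
split-at (y ∷ ys) (suc i) (s≤s i<n) with split-at ys i i<n
... | A , x , R , refl , refl = y ∷ A , x , R , refl , refl

break-above : ∀ x (R : List ℕ) →
  ∃₂ λ B T → R ≡ B ++ T × All (_≤ x) B × (T ≡ [] ⊎ ∃₂ λ t T₂ → T ≡ t ∷ T₂ × x < t)
break-above x []      = [] , [] , refl , [] , inj₁ refl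
break-above x (r ∷ R) with x <? r
... | yes x<r = [] , r ∷ R , refl , [] , inj₂ (r , R , refl , x<r)
... | no  x≮r with break-above x R
...   | B , T , refl , B≤x , T-starts = r ∷ B , T , refl , ≮⇒≥ x≮r ∷ B≤x , T-starts

-- What follows the block B in π = A x B T: if T is nonempty, the hook from x to the first
-- entry of T has its northeast endpoint in the tail, which forces T to be the tail.
run-after-block : ∀ {n} A x B T → InS n (A ++ x ∷ B ++ T) →
  (∀ j → Hook (A ++ x ∷ B ++ T) (suc (length A)) j → InTail (A ++ x ∷ B ++ T) j) →
  (T ≡ [] ⊎ ∃₂ λ t T₂ → T ≡ t ∷ T₂ × x < t) → Sorted T × Above (A ++ x ∷ B) T
run-after-block A x B _ _ _ (inj₁ refl) = [] , []
run-after-block {n} A x B _ π∈Sₙ tail-hooks (inj₂ (t , T₂ , refl , x<t)) =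
  tail-run L (t ∷ T₂) (subst (InS n) (sym reassociate) π∈Sₙ)
                      (subst (λ σ → InTail σ j₀) (sym reassociate) (tail-hooks j₀ hook))
  where
  L : List ℕ
  L = A ++ x ∷ B
  j₀ : ℕ
  j₀ = suc (length L)
  reassociate : L ++ t ∷ T₂ ≡ A ++ x ∷ B ++ t ∷ T₂
  reassociate = ++-assoc A (x ∷ B) (t ∷ T₂)
  length-L : length L ≡ length A + suc (length B)
  length-L = length-++ A
  hook : Hook (A ++ x ∷ B ++ t ∷ T₂) (suc (length A)) j₀
  hook = s≤s z≤n
       , s≤s (subst (length A <_) (sym length-L) (m<m+n (length A) (s≤s z≤n)))
       , subst (j₀ ≤_) (trans (sym (+-suc (length L) (length T₂))) (trans (sym (length-++ L)) (cong length reassociate)))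
               (s≤s (m≤m+n (length L) (length T₂)))
       , subst₂ _<_ (sym (at-after A (x ∷ B ++ t ∷ T₂)))
                    (sym (trans (cong (λ σ → at σ j₀) (sym reassociate)) (at-after L (t ∷ T₂)))) x<t

record DescentShape (π : List ℕ) (d : ℕ) : Set where
  constructor descent-shape
  field
    prefix       : List ℕ
    top          : ℕ
    block rest   : List ℕ
    π≡           : π ≡ prefix ++ top ∷ block ++ rest
    d≡           : d ≡ suc (length prefix)
    block≢[]     : block ≢ []
    block<top    : All (_< top) block
    admissible   : Admissible top block prefix rest

tail-bound-shape : ∀ {n π d} → InS n π → TailBound π d → DescentShape π d
tail-bound-shape {d = zero} _ ((() , _) , _)
tail-bound-shape {n} {π} {suc i} π∈Sₙ ((_ , d<n , descent) , tail-hooks)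
  with split-at π i (<-trans (n<1+n i) d<n)
... | A , x , [] , refl , refl = ⊥-elim (<-irrefl (sym (length-∷ʳ A x)) d<n)
... | A , x , r ∷ R , refl , refl with break-above x R
... | B₁ , T , refl , B₁≤x , T-starts =
  descent-shape A x (r ∷ B₁) T refl refl (λ ()) B<x
    (record { distinct = AxB-unique ; sorted = proj₁ run ; above = proj₂ run })
  where
  π-unique : Unique (A ++ x ∷ r ∷ B₁ ++ T)
  π-unique = Sₙ-unique π∈Sₙ
  r<x : r < x
  r<x = subst₂ _<_ (trans (cong (λ k → at (A ++ x ∷ r ∷ B₁ ++ T) (suc k)) (+-comm 1 (length A))) (at-++ A (x ∷ r ∷ B₁ ++ T) 1))
                   (at-after A (x ∷ r ∷ B₁ ++ T)) descent
  x∉rest : All (x ≢_) (r ∷ B₁ ++ T)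
  x∉rest = AllPairs.head (proj₂ (AllPairs-++⁻ A π-unique))
  -- the entries of B₁ are at most x and, π having distinct entries, different from x
  B<x : All (_< x) (r ∷ B₁)
  B<x = r<x ∷ All.zipWith (λ (v≤x , x≢v) → ≤∧≢⇒< v≤x (x≢v ∘ sym)) (B₁≤x , All.++⁻ˡ B₁ (All.tail x∉rest))
  AxB-unique : Unique (A ++ x ∷ r ∷ B₁)
  AxB-unique = proj₁ (AllPairs-++⁻ (A ++ x ∷ r ∷ B₁) (subst Unique (sym (++-assoc A (x ∷ r ∷ B₁) T)) π-unique))
  run : Sorted T × Above (A ++ x ∷ r ∷ B₁) T
  run = run-after-block A x (r ∷ B₁) T π∈Sₙ tail-hooks T-starts

corollary1 : ∀ (n : ℕ) (π : _) → InS n π → ∀ (d : ℕ) → TailBound π d →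
    preCount π ≡ sum (map (λ j → preCount (πU π d j) * preCount (πS π d j)) (SW π d))
corollary1 n π π∈Sₙ d tail-bound with tail-bound-shape π∈Sₙ tail-bound
... | descent-shape A x B T refl refl B≢[] B<x admissible =
  begin
    preCount (A ++ x ∷ B ++ T)                  ≡⟨ main-identity x B B≢[] B<x A T admissible ⟩
    hookSum x B A T                             ≡⟨ sym (hookTotal-at-x A x B T B<x x<T) ⟩
    hookTotal (A ++ x ∷ B ++ T) (suc (length A)) ∎
  where
  open ≡-Reasoning
  x<T : All (x <_) T
  x<T = All.map (λ above-t → All.lookup above-t (∈-++⁺ʳ A (here refl))) (Admissible.above admissible)
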